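{- Let $n,m\ge 3$ be odd. Then the wheel $W_n$ has chromatic number $4$, while every proper subgraph of $W_n$ has chromatic number $3$. Consequently, every graph homomorphism $f:W_n\to W_m$ is full.
   Context: Graphs are finite, simple and undirected. For $n\ge 3$, the wheel $W_n$ is the graph obtained from a cycle of length $n$ by adding an apex vertex adjacent to every vertex of the cycle. A homomorphism $f:G\to H$ is a map $V(G)\to V(H)$ sending edges to edges; it is full if it is surjective on vertices and every edge of $H$ is the image of some edge of $G$. -}

module Defs where

open import Data.Nat using (ℕ; zero; suc; _+_; _*_; _≤_; s≤s; z≤n)
open import Data.Nat.Properties using (m≢1+n+m)
open import Data.Fin using (Fin; toℕ)
open import Data.Product using (Σ; _×_; _,_; ∃; ∃-syntax)
open import Data.Sum using (_⊎_)
open import Relation.Binary.PropositionalEquality using (_≡_; _≢_; refl; sym; trans; cong; subst)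
open import Relation.Nullary using (¬_)
open import Data.Empty using (⊥)

record Graph : Set₁ where
  field
    V      : ℕ
    Adj    : Fin V → Fin V → Set
    Adj-sym    : ∀ {u v} → Adj u v → Adj v u
    Adj-irrefl : ∀ {u} → ¬ Adj u u
open Graph public

Odd : ℕ → Set
Odd n = ∃[ k ] n ≡ suc (2 * k)

-- Wheels.  W_n has vertex set Fin (suc n): vertex zero is the apex,
-- vertex suc i (i : Fin n) is the i-th vertex of the rim cycle
-- C_n = 0 - 1 - ... - (n-1) - 0.

data RimStep (n : ℕ) : Fin n → Fin n → Set where
  step : (i j : Fin n) → toℕ j ≡ suc (toℕ i) → RimStep n i j
  wrap : (i j : Fin n) → suc (toℕ i) ≡ n → toℕ j ≡ 0 → RimStep n i j

data WheelAdj (n : ℕ) : Fin (suc n) → Fin (suc n) → Set where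
  spokeOut : (i : Fin n) → WheelAdj n Fin.zero (Fin.suc i)
  spokeIn  : (i : Fin n) → WheelAdj n (Fin.suc i) Fin.zero
  rimFwd   : (i j : Fin n) → RimStep n i j → WheelAdj n (Fin.suc i) (Fin.suc j)
  rimBwd   : (i j : Fin n) → RimStep n j i → WheelAdj n (Fin.suc i) (Fin.suc j)

WheelAdj-sym : ∀ {n u v} → WheelAdj n u v → WheelAdj n v u
WheelAdj-sym (spokeOut i) = spokeIn i
WheelAdj-sym (spokeIn i) = spokeOut i
WheelAdj-sym (rimFwd i j r) = rimBwd j i r
WheelAdj-sym (rimBwd i j r) = rimFwd j i r

private
  bad3 : ∀ {n} → 3 ≤ n → suc 0 ≡ n → ⊥
  bad3 (s≤s (s≤s _)) ()

  n≢sn : ∀ n → n ≢ suc n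
  n≢sn zero ()
  n≢sn (suc n) e = n≢sn n (cong Data.Nat.pred e)

  rim-irrefl : ∀ {n} → 3 ≤ n → (i : Fin n) → ¬ RimStep n i i
  rim-irrefl _ i (step .i .i e) = n≢sn (toℕ i) e
  rim-irrefl le i (wrap .i .i e z) = bad3 le (trans (cong suc (sym z)) e)

WheelAdj-irrefl : ∀ {n} → 3 ≤ n → ∀ {u} → ¬ WheelAdj n u u
WheelAdj-irrefl le (rimFwd i .i r) = rim-irrefl le i r
WheelAdj-irrefl le (rimBwd i .i r) = rim-irrefl le i r

Wheel : (n : ℕ) → 3 ≤ n → Graph
Wheel n le = record
  { V = suc n
  ; Adj = WheelAdj n
  ; Adj-sym = WheelAdj-sym
  ; Adj-irrefl = WheelAdj-irrefl le
  }

Colourable : Graph → ℕ → Set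
Colourable G k = Σ (Fin (V G) → Fin k) λ c → ∀ u v → Adj G u v → c u ≢ c v

-- χ(G) = k : G is k-colourable but not (k-1)-colourable
-- (for k ≥ 1, this pins down the least k; colourability is monotone in k).
ChromaticNumber≡ : Graph → ℕ → Set
ChromaticNumber≡ G zero    = ¬ (Fin (V G))  -- only the empty graph is 0-colourable
ChromaticNumber≡ G (suc k) = Colourable G (suc k) × ¬ Colourable G k

record Subgraph (G : Graph) : Set₁ where
  field
    S     : Fin (V G) → Set
    E     : Fin (V G) → Fin (V G) → Set
    E-sym : ∀ {u v} → E u v → E v u
    E⊆G   : ∀ {u v} → E u v → Adj G u v
    E⊆S   : ∀ {u v} → E u v → S u × S v
open Subgraph public

Proper : ∀ {G} → Subgraph G → Set
Proper {G} H = (Σ (Fin (V G)) λ v → ¬ S H v)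
             ⊎ (Σ (Fin (V G)) λ u → Σ (Fin (V G)) λ v → Adj G u v × ¬ E H u v)

-- H is properly k-colourable (colours of vertices outside S are irrelevant).
SubColourable : ∀ {G} → Subgraph G → ℕ → Set
SubColourable {G} H k =
  Σ (Fin (V G) → Fin k) λ c → ∀ u v → E H u v → c u ≢ c v

Hom : Graph → Graph → Set
Hom G H = Σ (Fin (V G) → Fin (V H)) λ f → ∀ u v → Adj G u v → Adj H (f u) (f v)

Full : (G H : Graph) → Hom G H → Set
Full G H (f , _) =
  (∀ y → Σ (Fin (V G)) λ x → f x ≡ y)
  × (∀ y₁ y₂ → Adj H y₁ y₂ →
       Σ (Fin (V G)) λ x₁ → Σ (Fin (V G)) λ x₂ →
         Adj G x₁ x₂ × f x₁ ≡ y₁ × f x₂ ≡ y₂)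

{-# OPTIONS --safe #-}

-- An odd wheel needs four colours: the apex takes a colour of its own, leaving only two
-- for the odd rim cycle.  Once an edge is missing (a missing vertex takes its edges with
-- it), three colours suffice: without the spoke to t, the rim vertex t may share the apex
-- colour and the rest of the rim is a path; without a rim edge, the rim is a path.
-- Colourings of the image of a homomorphism pull back, so the image of an odd wheel in a
-- wheel cannot be a proper subgraph.
module Submission where

open import Defs
open import Data.Nat using (ℕ; zero; suc; _≤_; _<_; _∸_; _+_; _*_; s≤s; s≤s⁻¹)
open import Data.Nat.Properties as ℕ
  using (_<?_; +-∸-assoc; +-suc; ≤-antisym; ≤-trans; m≤n+m; m<n⇒m<1+n; ≮⇒≥; <⇒≢;
         n<1+n; n≤1+n)
open import Data.Fin using (Fin; zero; suc; toℕ; fromℕ; fromℕ<; inject₁; punchOut)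
open import Data.Fin.Properties
  using (_≟_; any?; toℕ-injective; toℕ<n; toℕ-fromℕ<; suc-injective;
         fromℕ≢inject₁; inject₁-injective; punchOut-injective)
open import Data.Vec.Functional using (_∷_)
open import Data.Product using (Σ; ∃; _×_; _,_; proj₁; proj₂)
open import Data.Sum using (_⊎_; inj₁; inj₂; [_,_])
open import Function using (_∘_)
open import Relation.Nullary using (¬_; Dec; yes; no; contradiction)
open import Relation.Nullary.Decidable using (map′; _×-dec_; _⊎-dec_; decidable-stable)
open import Relation.Binary.PropositionalEquality using (_≡_; _≢_; refl; sym; trans; cong)

private
  variable
    k n : ℕ
    G H : Graph

image : Hom G H → Subgraph H
image {G} {H} (f , f-hom) = record
  { S     = λ y → Σ (Fin (V G)) λ x → f x ≡ y
  ; E     = λ y₁ y₂ → Σ (Fin (V G)) λ x₁ → Σ (Fin (V G)) λ x₂ →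
              Adj G x₁ x₂ × f x₁ ≡ y₁ × f x₂ ≡ y₂
  ; E-sym = λ { (x₁ , x₂ , a , e₁ , e₂) → x₂ , x₁ , Adj-sym G a , e₂ , e₁ }
  ; E⊆G   = λ { (x₁ , x₂ , a , refl , refl) → f-hom x₁ x₂ a }
  ; E⊆S   = λ { (x₁ , x₂ , _ , e₁ , e₂) → (x₁ , e₁) , (x₂ , e₂) }
  }

colouring-pullback : (f : Hom G H) → SubColourable (image {G} {H} f) k → Colourable G k
colouring-pullback (f , _) (c , proper) =
  c ∘ f , λ u v a → proper (f u) (f v) (u , v , a , refl , refl)

¬Proper-image⇒Full : (∀ u v → Dec (Adj G u v)) → (f : Hom G H) →
                     ¬ Proper (image {G} {H} f) → Full G H f
¬Proper-image⇒Full adj? (f , _) improper =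
  (λ y → decidable-stable (any? λ x → f x ≟ y) (improper ∘ inj₁ ∘ (y ,_)))
  , λ y₁ y₂ a → decidable-stable
      (any? λ x₁ → any? λ x₂ → adj? x₁ x₂ ×-dec f x₁ ≟ y₁ ×-dec f x₂ ≟ y₂)
      (λ ∉E → improper (inj₂ (y₁ , y₂ , a , ∉E)))

homomorphisms-full : (G H : Graph) → (∀ u v → Dec (Adj G u v)) → ¬ Colourable G k →
                     ((S : Subgraph H) → Proper S → SubColourable S k) →
                     (f : Hom G H) → Full G H f
homomorphisms-full G H adj? ¬col critical f =
  ¬Proper-image⇒Full {G} {H} adj? f
    (¬col ∘ colouring-pullback {G} {H} f ∘ critical (image {G} {H} f))

proper-subgraph-misses-edge : (∀ v → ∃ λ u → Adj G v u) →
                              (S : Subgraph G) → Proper S →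
                              Σ (Fin (V G)) λ a → Σ (Fin (V G)) λ b → Adj G a b × ¬ E S a b
proper-subgraph-misses-edge nbr S (inj₁ (v , ∉S)) =
  v , proj₁ (nbr v) , proj₂ (nbr v) , ∉S ∘ proj₁ ∘ E⊆S S
proper-subgraph-misses-edge nbr S (inj₂ missing) = missing

ProperExcept : (G : Graph) → (Fin (V G) → Fin k) → Fin (V G) → Fin (V G) → Set
ProperExcept G c a b =
  ∀ u v → Adj G u v → c u ≡ c v → (u ≡ a × v ≡ b) ⊎ (u ≡ b × v ≡ a)

properExcept-colours-subgraph : {c : Fin (V G) → Fin k} {a b : Fin (V G)} →
                                ProperExcept G c a b → (S : Subgraph G) → ¬ E S a b →
                                SubColourable S k
properExcept-colours-subgraph {c = c} proper S ∉E = c , λ u v e c≡ →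
  [ (λ { (refl , refl) → ∉E e }) , (λ { (refl , refl) → ∉E (E-sym S e) }) ]
    (proper u v (E⊆G S e) c≡)

RimStep-irrefl : 3 ≤ n → {i : Fin n} → ¬ RimStep n i i
RimStep-irrefl hn r = WheelAdj-irrefl hn (rimFwd _ _ r)

RimStep-functional : {i j j′ : Fin n} → RimStep n i j → RimStep n i j′ → j ≡ j′
RimStep-functional (step _ _ e) (step _ _ e′) = toℕ-injective (trans e (sym e′))
RimStep-functional (step _ j e) (wrap _ _ w _) = contradiction (trans e w) (<⇒≢ (toℕ<n j))
RimStep-functional (wrap _ _ w _) (step _ j e) = contradiction (trans e w) (<⇒≢ (toℕ<n j))
RimStep-functional (wrap _ _ _ z) (wrap _ _ _ z′) = toℕ-injective (trans z (sym z′))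

RimStep? : (i j : Fin n) → Dec (RimStep n i j)
RimStep? {n} i j =
  map′ [ step i j , (λ (w , z) → wrap i j w z) ]
       (λ { (step _ _ e) → inj₁ e ; (wrap _ _ w z) → inj₂ (w , z) })
       (toℕ j ℕ.≟ suc (toℕ i) ⊎-dec suc (toℕ i) ℕ.≟ n ×-dec toℕ j ℕ.≟ 0)

WheelAdj? : (u v : Fin (suc n)) → Dec (WheelAdj n u v)
WheelAdj? zero    zero    = no λ ()
WheelAdj? zero    (suc j) = yes (spokeOut j)
WheelAdj? (suc i) zero    = yes (spokeIn i)
WheelAdj? (suc i) (suc j) =
  map′ [ rimFwd i j , rimBwd i j ]
       (λ { (rimFwd _ _ r) → inj₁ r ; (rimBwd _ _ r) → inj₂ r })
       (RimStep? i j ⊎-dec RimStep? j i)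

wheel-neighbour : 3 ≤ n → (v : Fin (suc n)) → ∃ λ u → WheelAdj n v u
wheel-neighbour (s≤s _) zero    = suc zero , spokeOut zero
wheel-neighbour _       (suc i) = zero , spokeIn i

-- (x − t − 1) mod n: the position of x on the rim path that starts right after t.
offset : ℕ → ℕ → ℕ → ℕ
offset n t x with t <? x
... | yes _ = x ∸ suc t
... | no  _ = x + n ∸ suc t

offset-suc : ∀ {n t x} → t < n → x ≢ t → offset n t (suc x) ≡ suc (offset n t x)
offset-suc {n} {t} {x} t<n x≢t with t <? x | t <? suc x
... | yes t<x | yes _       = +-∸-assoc 1 t<x
... | yes t<x | no  t≮1+x   = contradiction (m<n⇒m<1+n t<x) t≮1+x
... | no  t≮x | yes t<1+x   = contradiction (≤-antisym (≮⇒≥ t≮x) (s≤s⁻¹ t<1+x)) x≢t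
... | no  _   | no  _       = +-∸-assoc 1 (≤-trans t<n (m≤n+m n x))

offset-wrap : ∀ {n t x} → t < n → x ≢ t → suc x ≡ n → offset n t 0 ≡ suc (offset n t x)
offset-wrap {t = t} {x} t<n x≢t refl with t <? x
... | yes t<x = +-∸-assoc 1 t<x
... | no  t≮x = contradiction (≤-antisym (≮⇒≥ t≮x) (s≤s⁻¹ t<n)) x≢t

rimOffset : Fin n → Fin n → ℕ
rimOffset {n} t x = offset n (toℕ t) (toℕ x)

rimOffset-step : {t i j : Fin n} → RimStep n i j → i ≢ t →
                 rimOffset t j ≡ suc (rimOffset t i)
rimOffset-step {t = t} (step i j e) i≢t rewrite e =
  offset-suc (toℕ<n t) (i≢t ∘ toℕ-injective)
rimOffset-step {t = t} (wrap i j w z) i≢t rewrite z =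
  offset-wrap (toℕ<n t) (i≢t ∘ toℕ-injective) w

parity : ℕ → Fin 2
parity zero          = zero
parity (suc zero)    = suc zero
parity (suc (suc k)) = parity k

parity-suc : ∀ k → parity (suc k) ≢ parity k
parity-suc zero          ()
parity-suc (suc zero)    ()
parity-suc (suc (suc k)) = parity-suc k

parity-double : ∀ k → parity (2 * k) ≡ zero
parity-double zero    = refl
parity-double (suc k) rewrite +-suc k (k + 0) = parity-double k

RimColouring : ℕ → ℕ → Set
RimColouring n k = Σ (Fin n → Fin k) λ c → ∀ {i j} → RimStep n i j → c i ≢ c j

pathColouring : Fin n → Fin n → Fin 3
pathColouring t x = suc (parity (rimOffset t x))

pathColouring-step : {t i j : Fin n} → RimStep n i j → i ≢ t →
                     pathColouring t i ≢ pathColouring t j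
pathColouring-step {t = t} {i} r i≢t rewrite rimOffset-step r i≢t =
  parity-suc (rimOffset t i) ∘ sym ∘ suc-injective

rimColouring : Fin n → Fin n → Fin 3
rimColouring t x with x ≟ t
... | yes _ = zero
... | no  _ = pathColouring t x

rimColouring-proper : 3 ≤ n → (t : Fin n) → {i j : Fin n} → RimStep n i j →
                      rimColouring t i ≢ rimColouring t j
rimColouring-proper hn t {i} {j} r with i ≟ t | j ≟ t
... | yes refl | yes refl = contradiction r (RimStep-irrefl hn)
... | yes _    | no  _    = λ ()
... | no  _    | yes _    = λ ()
... | no  i≢t  | no  _    = pathColouring-step r i≢t

rim-3-colouring : 3 ≤ n → RimColouring n 3
rim-3-colouring hn@(s≤s _) = rimColouring zero , rimColouring-proper hn zero

odd-rim-not-2-colourable : Odd n → ¬ RimColouring n 2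
odd-rim-not-2-colourable {n} (k , refl) (c , proper) =
  proper (wrap _ zero (cong suc (toℕ-fromℕ< last)) refl)
         (even-positions-agree (2 * k) last (parity-double k))
  where
  last : 2 * k < n
  last = n<1+n (2 * k)

  step-at : ∀ {i} (p : i < n) (q : suc i < n) → RimStep n (fromℕ< p) (fromℕ< q)
  step-at p q = step _ _ (trans (toℕ-fromℕ< q) (cong suc (sym (toℕ-fromℕ< p))))

  two-colours : {x y z : Fin 2} → x ≢ y → y ≢ z → x ≡ z
  two-colours {zero}     {zero}     x≢y _ = contradiction refl x≢y
  two-colours {suc zero} {suc zero} x≢y _ = contradiction refl x≢y
  two-colours {_} {zero}     {zero}     _ y≢z = contradiction refl y≢z
  two-colours {_} {suc zero} {suc zero} _ y≢z = contradiction refl y≢z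
  two-colours {zero}     {suc zero} {zero}     _ _ = refl
  two-colours {suc zero} {zero}     {suc zero} _ _ = refl

  even-positions-agree : ∀ i (p : i < n) → parity i ≡ zero → c (fromℕ< p) ≡ c zero
  even-positions-agree zero          _ _ = refl
  even-positions-agree (suc zero)    _ ()
  even-positions-agree (suc (suc i)) p even =
    trans (sym (two-colours (proper (step-at p₀ p₁)) (proper (step-at p₁ p))))
          (even-positions-agree i p₀ even)
    where
    p₁ = ≤-trans (n≤1+n _) p
    p₀ = ≤-trans (n≤1+n _) p₁

module _ {n : ℕ} {hn : 3 ≤ n} where

  -- The apex sees every rim vertex, so its colour is missing from the whole rim.
  rim-colouring-of-wheel : Colourable (Wheel n hn) (suc k) → RimColouring n k
  rim-colouring-of-wheel (c , proper) =
    (λ i → punchOut (apex≢ i))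
    , λ {i} {j} r → proper (suc i) (suc j) (rimFwd i j r)
                    ∘ punchOut-injective (apex≢ i) (apex≢ j)
    where
    apex≢ : (i : Fin n) → c zero ≢ c (suc i)
    apex≢ i = proper zero (suc i) (spokeOut i)

  wheel-colouring-of-rim : RimColouring n k → Colourable (Wheel n hn) (suc k)
  wheel-colouring-of-rim {k} (c , proper) = fromℕ k ∷ (inject₁ ∘ c) , λ where
    _ _ (spokeOut i)   → fromℕ≢inject₁
    _ _ (spokeIn i)    → fromℕ≢inject₁ ∘ sym
    _ _ (rimFwd i j r) → proper r ∘ inject₁-injective
    _ _ (rimBwd i j r) → proper r ∘ sym ∘ inject₁-injective

  rimColouring-properExcept : (t : Fin n) →
                              ProperExcept (Wheel n hn) (zero ∷ rimColouring t) zero (suc t)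
  rimColouring-properExcept t _ _ (spokeOut i) eq with i ≟ t
  rimColouring-properExcept t _ _ (spokeOut i) eq | yes refl = inj₁ (refl , refl)
  rimColouring-properExcept t _ _ (spokeOut i) () | no  _
  rimColouring-properExcept t _ _ (spokeIn i) eq with i ≟ t
  rimColouring-properExcept t _ _ (spokeIn i) eq | yes refl = inj₂ (refl , refl)
  rimColouring-properExcept t _ _ (spokeIn i) () | no  _
  rimColouring-properExcept t _ _ (rimFwd i j r) eq =
    contradiction eq (rimColouring-proper hn t r)
  rimColouring-properExcept t _ _ (rimBwd i j r) eq =
    contradiction (sym eq) (rimColouring-proper hn t r)

  pathColouring-properExcept : {t s : Fin n} → RimStep n t s →
                               ProperExcept (Wheel n hn) (zero ∷ pathColouring t) (suc t) (suc s)
  pathColouring-properExcept r _ _ (spokeOut i) ()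
  pathColouring-properExcept r _ _ (spokeIn i) ()
  pathColouring-properExcept {t} r _ _ (rimFwd i j r′) eq with i ≟ t
  ... | yes refl = inj₁ (refl , cong suc (RimStep-functional r′ r))
  ... | no  i≢t  = contradiction eq (pathColouring-step r′ i≢t)
  pathColouring-properExcept {t} r _ _ (rimBwd i j r′) eq with j ≟ t
  ... | yes refl = inj₂ (cong suc (RimStep-functional r′ r) , refl)
  ... | no  j≢t  = contradiction (sym eq) (pathColouring-step r′ j≢t)

  proper-subgraph-3-colourable : (S : Subgraph (Wheel n hn)) → Proper S → SubColourable S 3
  proper-subgraph-3-colourable S proper
    with proper-subgraph-misses-edge (wheel-neighbour hn) S proper
  ... | _ , _ , spokeOut t   , ∉E =
    properExcept-colours-subgraph (rimColouring-properExcept t) S ∉E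
  ... | _ , _ , spokeIn t    , ∉E =
    properExcept-colours-subgraph (rimColouring-properExcept t) S (∉E ∘ E-sym S)
  ... | _ , _ , rimFwd _ _ r , ∉E =
    properExcept-colours-subgraph (pathColouring-properExcept r) S ∉E
  ... | _ , _ , rimBwd _ _ r , ∉E =
    properExcept-colours-subgraph (pathColouring-properExcept r) S (∉E ∘ E-sym S)

odd-wheel-not-3-colourable : (hn : 3 ≤ n) → Odd n → ¬ Colourable (Wheel n hn) 3
odd-wheel-not-3-colourable hn odd =
  odd-rim-not-2-colourable odd ∘ rim-colouring-of-wheel {hn = hn}

lemma3p2 : (n m : ℕ) (hn : 3 ≤ n) (hm : 3 ≤ m) → Odd n → Odd m →
    ChromaticNumber≡ (Wheel n hn) 4
    × ((H : Subgraph (Wheel n hn)) → Proper H → SubColourable H 3)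
    × ((f : Hom (Wheel n hn) (Wheel m hm)) → Full (Wheel n hn) (Wheel m hm) f)
lemma3p2 n m hn hm odd-n _ =
  (wheel-colouring-of-rim {hn = hn} (rim-3-colouring hn) , odd-wheel-not-3-colourable hn odd-n)
  , proper-subgraph-3-colourable {hn = hn}
  , homomorphisms-full (Wheel n hn) (Wheel m hm) WheelAdj?
      (odd-wheel-not-3-colourable hn odd-n) (proper-subgraph-3-colourable {hn = hm})
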